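{- Let $N$ and $b$ be non-negative integers with $b>0$ if $N=0$, and let $e_1,\dots,e_N$ be non-negative integers with $e_1\ge1$ if $N>0$. Let $\mathcal{E}$ be the Zeckendorf collection for positive integers with immediate predecessors $\hat\beta^n=\sum_{k=1}^{n-1}e_k\beta^{n-k}$ for $2\le n\le N+1$ and $\hat\beta^n=\sum_{k=1}^{n-N-1}b\beta^k+\sum_{k=1}^Ne_k\beta^{n-k}$ for $n\ge N+2$. Let $Q$ be the increasing fundamental sequence for the $\mathcal{E}$-set of numbers $\mathbb{N}$. Then for all $n\ge N+2$, $$Q_n=(e_1+1)Q_{n-1}+\sum_{k=2}^N(e_k-e_{k-1})Q_{n-k}+(b-e_N)Q_{n-N-1}.$$
   Context: $\mathbb{N}=\{1,2,\dots\}$. A coefficient function is a map $\epsilon:\mathbb{N}\to\{0,1,2,\dots\}$; $\sum\epsilon Q=\sum_k\epsilon_kQ_k$; $\beta^i$ has $\beta^i_i=1$ and $0$ elsewhere. For finite-support functions, $\mu<_a\mu'$ means at the largest index $k$ where they differ $\mu_k<\mu'_k$. A Zeckendorf collection for positive integers is a set $\mathcal{E}$ of finite-support coefficient functions containing $0$ and all $\beta^i$, ordered by $<_a$, with $\hat\beta^n$ the largest element below $\beta^n$, such that (1) each $\mu\in\mathcal{E}$ has finitely many elements below it, and (2) for $\mu\in\mathcal{E}$, if its immediate successor (smallest greater element) $\tilde\mu$ is not $\beta^1+\mu$, then there is $n\ge2$ with $\mu_k=\hat\beta^n_k$ for $k<n$ and $\tilde\mu=\beta^n+\sum_{k\ge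 n}\mu_k\beta^k$; it is uniquely determined by its immediate predecessors $\hat\beta^n$. The increasing fundamental sequence for $\mathbb{N}$ is the unique strictly increasing sequence $Q$ of positive integers such that the values $\sum\delta Q$, $\delta\in\mathcal{E}$, are pairwise distinct and $\{\sum\delta Q:\delta\in\mathcal{E},\delta\ne0\}=\mathbb{N}$; it satisfies $Q_1=1$ and $Q_n=1+\sum\hat\beta^nQ$ for $n\ge2$. -}

module Defs where

open import Data.Nat using (ℕ; zero; suc; _+_; _*_; _∸_; _≤_; _<_; _≟_; _<?_)
open import Data.Integer as ℤ using (ℤ)
open import Data.Fin using (Fin; fromℕ<)
open import Data.List using (List)
open import Data.List.Relation.Unary.Any using (Any)
open import Data.Product using (Σ; ∃; ∃-syntax; _×_)
open import Data.Sum using (_⊎_)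
open import Relation.Nullary using (¬_; yes; no)
open import Relation.Binary.PropositionalEquality using (_≡_; _≗_)

-- Coefficient functions ε : ℕ → ℕ, using the paper's indexing:
-- ε k is the coefficient at position k ≥ 1.  Position 0 is not used;
-- members of a Zeckendorf collection are required to have ε 0 ≡ 0.
Coef : Set
Coef = ℕ → ℕ

0c : Coef
0c _ = 0

β : ℕ → Coef
β i j with i ≟ j
... | yes _ = 1
... | no  _ = 0

_+c_ : Coef → Coef → Coef
(μ +c ν) k = μ k + ν k

_·c_ : ℕ → Coef → Coef
(c ·c μ) k = c * μ k

Σc : ℕ → ℕ → (ℕ → Coef) → Coef
Σc lo hi F = go (suc hi ∸ lo) lo
  where
  go : ℕ → ℕ → Coef
  go zero    _ = 0c
  go (suc c) k = F k +c go c (suc k)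

Σℤ : ℕ → ℕ → (ℕ → ℤ) → ℤ
Σℤ lo hi f = go (suc hi ∸ lo) lo
  where
  go : ℕ → ℕ → ℤ
  go zero    _ = ℤ.0ℤ
  go (suc c) k = f k ℤ.+ go c (suc k)

sumTo : ℕ → (ℕ → ℕ) → ℕ
sumTo zero    f = 0
sumTo (suc B) f = sumTo B f + f (suc B)

FinSupp : Coef → Set
FinSupp μ = ∃[ B ] (∀ k → B < k → μ k ≡ 0)

-- Σ δ Q = m  (the sum over a bound B of the support; independent of B)
HasValue : Coef → (ℕ → ℕ) → ℕ → Set
HasValue δ Q m = ∃[ B ] ((∀ k → B < k → δ k ≡ 0) × sumTo B (λ k → δ k * Q k) ≡ m)

_<a_ : Coef → Coef → Set
μ <a ν = ∃[ k ] (μ k < ν k × (∀ j → k < j → μ j ≡ ν j))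

_≤a_ : Coef → Coef → Set
μ ≤a ν = μ <a ν ⊎ μ ≗ ν

IsImmSucc : (Coef → Set) → Coef → Coef → Set
IsImmSucc E μ ν = μ <a ν × (∀ ρ → E ρ → μ <a ρ → ν ≤a ρ)

succShape : ℕ → Coef → Coef
succShape n μ k with k <? n
... | yes _ = β n k
... | no  _ = β n k + μ k

record IsZeckendorfCollection (E : Coef → Set) (βhat : ℕ → Coef) : Set where
  field
    -- E is a set of finite-support coefficient functions (closed under
    -- pointwise equality, since functions are compared pointwise)
    resp      : ∀ μ ν → μ ≗ ν → E μ → E ν
    pos0      : ∀ μ → E μ → μ 0 ≡ 0
    finSupp   : ∀ μ → E μ → FinSupp μ
    zero∈     : E 0c
    β∈        : ∀ i → 1 ≤ i → E (β i)
    pred∈     : ∀ n → 2 ≤ n → E (βhat n)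
    pred<     : ∀ n → 2 ≤ n → βhat n <a β n
    predMax   : ∀ n → 2 ≤ n → ∀ ν → E ν → ν <a β n → ν ≤a βhat n
    finBelow  : ∀ μ → E μ → Σ (List Coef) λ L → ∀ ν → E ν → ν <a μ → Any (ν ≗_) L
    succCond  : ∀ μ ν → E μ → E ν → IsImmSucc E μ ν → ¬ (ν ≗ (β 1 +c μ)) →
                ∃[ n ] (2 ≤ n × (∀ k → 1 ≤ k → k < n → μ k ≡ βhat n k)
                              × ν ≗ succShape n μ)

-- Q is the increasing fundamental sequence for ℕ = {1,2,…} w.r.t. E
-- (Q 0 is unused)
record IsFundamentalSequence (E : Coef → Set) (Q : ℕ → ℕ) : Set where
  field
    positive  : ∀ n → 1 ≤ n → 1 ≤ Q n
    increasing : ∀ n → 1 ≤ n → Q n < Q (suc n)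
    distinct  : ∀ δ δ′ m → E δ → E δ′ → HasValue δ Q m → HasValue δ′ Q m → δ ≗ δ′
    covers    : ∀ m → 1 ≤ m → ∃[ δ ] (E δ × ¬ (δ ≗ 0c) × HasValue δ Q m)
    onlyPos   : ∀ δ m → E δ → ¬ (δ ≗ 0c) → HasValue δ Q m → 1 ≤ m

-- e_1,…,e_N given as e : Fin N → ℕ (Fin index i ↦ e_{i+1});
-- ext e k = e_k for 1 ≤ k ≤ N and 0 otherwise (convention e_0 = 0 etc.)
ext : ∀ {N} → (Fin N → ℕ) → ℕ → ℕ
ext {N} e zero = 0
ext {N} e (suc k) with k <? N
... | yes p = e (fromℕ< p)
... | no  _ = 0

βhatSpec : (N b : ℕ) → (Fin N → ℕ) → ℕ → Coef
βhatSpec N b e n with n ≤? suc N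
  where open import Data.Nat using (_≤?_)
... | yes _ = Σc 1 (n ∸ 1) (λ k → ext e k ·c β (n ∸ k))
... | no  _ = Σc 1 (n ∸ N ∸ 1) (λ k → b ·c β k) +c Σc 1 N (λ k → ext e k ·c β (n ∸ k))

module Submission where

-- Write rep r for the element of E of value r. By induction on r, rep 0, rep 1, …, rep r are
-- consecutive in E. Indeed the immediate successor of rep r is either β¹ + rep r, of value
-- r + 1, or β^n plus the part of rep r from n on, where rep r agrees with β̂^n below n; then
-- β̂^n ≤ rep r is some rep s, its immediate successor β^n is rep (s + 1), so Q_n = s + 1 and
-- the value is again r + 1. This gives Q_n = 1 + Σ β̂^n Q for n ≥ 2, which for the given β̂^n
-- reads Q_n = 1 + b (Q_1 + … + Q_{n-N-1}) + Σ_{k=1}^N e_k Q_{n-k}; subtracting the instance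
-- for n - 1, with a summation by parts in the e_k, yields the recurrence. Immediate
-- successors are found only classically, but the conclusion is a decidable equation between
-- naturals and thus stable under double negation.

open import Defs
open import Data.Nat as ℕ hiding (_*_)
open import Data.Nat.Properties
open import Algebra.Properties.CommutativeSemigroup +-commutativeSemigroup using (interchange)
open import Data.Fin using (Fin)
import Data.Integer.Properties as ℤ
open import Data.Integer.Tactic.RingSolver using (solve-∀)
open import Data.List using (List; []; _∷_)
open import Data.List.Relation.Unary.Any using (Any; here; there)
open import Data.Product using (∃-syntax; _×_; _,_; proj₁; proj₂)
open import Data.Sum using (_⊎_; inj₁; inj₂; [_,_])
open import Data.Empty using (⊥-elim)
open import Effect.Monad using (RawMonad)
open import Function using (id)
open import Level using (0ℓ)
open import Relation.Nullary using (¬_; Dec; yes; no)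
open import Relation.Nullary.Negation using (DoubleNegation; ¬¬-Monad)
open import Relation.Nullary.Decidable using (¬¬-excluded-middle; decidable-stable)
open import Relation.Binary.PropositionalEquality
  using (_≡_; _≢_; refl; sym; trans; cong; cong₂; subst; subst₂; _≗_; module ≡-Reasoning)
open import Relation.Binary.Definitions using (tri<; tri≈; tri>)

private
  variable
    μ μ′ ν ν′ ρ : Coef
    i j k m n p r s B : ℕ

β-diag : ∀ k → β k k ≡ 1
β-diag k with k ≟ k
... | yes _ = refl
... | no k≢k = ⊥-elim (k≢k refl)

β-offdiag : k ≢ j → β k j ≡ 0
β-offdiag {k} {j} k≢j with k ≟ j
... | yes k≡j = ⊥-elim (k≢j k≡j)
... | no _ = refl

≗-sym : μ ≗ ν → ν ≗ μ
≗-sym eq k = sym (eq k)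

≗-trans : μ ≗ ν → ν ≗ ρ → μ ≗ ρ
≗-trans eq eq′ k = trans (eq k) (eq′ k)

<a-irrefl : ¬ (μ <a μ)
<a-irrefl (k , μk<μk , _) = <-irrefl refl μk<μk

<a-resp-≗ : μ ≗ μ′ → ν ≗ ν′ → μ <a ν → μ′ <a ν′
<a-resp-≗ eqμ eqν (k , lt , above) =
  k , subst₂ _<_ (eqμ k) (eqν k) lt , λ j k<j → trans (sym (eqμ j)) (trans (above j k<j) (eqν j))

<a-trans : μ <a ν → ν <a ρ → μ <a ρ
<a-trans {μ} {ν} {ρ} (k , lt , above) (k′ , lt′ , above′) with <-cmp k k′
... | tri< k<k′ _ _ =
  k′ , subst (_< ρ k′) (sym (above k′ k<k′)) lt′ ,
  λ j k′<j → trans (above j (<-trans k<k′ k′<j)) (above′ j k′<j)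
... | tri≈ _ refl _ = k , <-trans lt lt′ , λ j k<j → trans (above j k<j) (above′ j k<j)
... | tri> _ _ k′<k =
  k , subst (μ k <_) (above′ k k′<k) lt ,
  λ j k<j → trans (above j k<j) (above′ j (<-trans k′<k k<j))

<a-≤a-trans : μ <a ν → ν ≤a ρ → μ <a ρ
<a-≤a-trans lt (inj₁ lt′) = <a-trans lt lt′
<a-≤a-trans lt (inj₂ eq) = <a-resp-≗ (λ _ → refl) eq lt

≤a-<a-trans : μ ≤a ν → ν <a ρ → μ <a ρ
≤a-<a-trans (inj₁ lt) lt′ = <a-trans lt lt′
≤a-<a-trans (inj₂ eq) lt′ = <a-resp-≗ (≗-sym eq) (λ _ → refl) lt′

≤a-resp-≗ : μ ≗ μ′ → ν ≗ ν′ → μ ≤a ν → μ′ ≤a ν′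
≤a-resp-≗ eqμ eqν (inj₁ lt) = inj₁ (<a-resp-≗ eqμ eqν lt)
≤a-resp-≗ eqμ eqν (inj₂ eq) = inj₂ (≗-trans (≗-sym eqμ) (≗-trans eq eqν))

Trichotomy : Coef → Coef → Set
Trichotomy μ ν = μ <a ν ⊎ μ ≗ ν ⊎ ν <a μ

<a-trichotomy-above : ∀ B → (∀ k → B < k → μ k ≡ ν k) → Trichotomy μ ν
<a-trichotomy-above {μ} {ν} zero above with <-cmp (μ 0) (ν 0)
... | tri< lt _ _ = inj₁ (0 , lt , above)
... | tri≈ _ eq _ = inj₂ (inj₁ λ { zero → eq ; (suc k) → above (suc k) z<s })
... | tri> _ _ gt = inj₂ (inj₂ (0 , gt , λ j 0<j → sym (above j 0<j)))
<a-trichotomy-above {μ} {ν} (suc B) above with <-cmp (μ (suc B)) (ν (suc B))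
... | tri< lt _ _ = inj₁ (suc B , lt , above)
... | tri> _ _ gt = inj₂ (inj₂ (suc B , gt , λ j B<j → sym (above j B<j)))
... | tri≈ _ eq _ = <a-trichotomy-above B above′
  where
  above′ : ∀ k → B < k → μ k ≡ ν k
  above′ k B<k with k ≟ suc B
  ... | yes refl = eq
  ... | no k≢1+B = above k (≤∧≢⇒< B<k (λ eq → k≢1+B (sym eq)))

<a-trichotomy : FinSupp μ → FinSupp ν → Trichotomy μ ν
<a-trichotomy (B , vanish) (B′ , vanish′) = <a-trichotomy-above (B ⊔ B′) λ k B⊔B′<k →
  trans (vanish k (≤-<-trans (m≤m⊔n B B′) B⊔B′<k)) (sym (vanish′ k (≤-<-trans (m≤n⊔m B B′) B⊔B′<k)))

pointwise-≤⇒≤a : FinSupp μ → FinSupp ν → (∀ k → μ k ≤ ν k) → μ ≤a ν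
pointwise-≤⇒≤a fsμ fsν μ≤ν with <a-trichotomy fsμ fsν
... | inj₁ lt = inj₁ lt
... | inj₂ (inj₁ eq) = inj₂ eq
... | inj₂ (inj₂ (k , νk<μk , _)) = ⊥-elim (<⇒≱ νk<μk (μ≤ν k))

<a-β-above-support : (∀ k → B < k → μ k ≡ 0) → μ <a β (suc B)
<a-β-above-support {B} {μ} vanish =
  suc B , subst₂ _<_ (sym (vanish (suc B) ≤-refl)) (sym (β-diag (suc B))) z<s ,
  λ j 1+B<j → trans (vanish j (<-trans (n<1+n B) 1+B<j)) (sym (β-offdiag (λ eq → <-irrefl eq 1+B<j)))

sumTo-cong : ∀ B {f g : ℕ → ℕ} → (∀ k → f k ≡ g k) → sumTo B f ≡ sumTo B g
sumTo-cong zero eq = refl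
sumTo-cong (suc B) eq = cong₂ _+_ (sumTo-cong B eq) (eq (suc B))

sumTo-distrib-+ : ∀ B f g → sumTo B (λ k → f k + g k) ≡ sumTo B f + sumTo B g
sumTo-distrib-+ zero f g = refl
sumTo-distrib-+ (suc B) f g =
  trans (cong (_+ (f (suc B) + g (suc B))) (sumTo-distrib-+ B f g))
    (interchange (sumTo B f) (sumTo B g) (f (suc B)) (g (suc B)))

sumTo-distribˡ-* : ∀ B c f → sumTo B (λ k → c ℕ.* f k) ≡ c ℕ.* sumTo B f
sumTo-distribˡ-* zero c f = sym (*-zeroʳ c)
sumTo-distribˡ-* (suc B) c f =
  trans (cong (_+ c ℕ.* f (suc B)) (sumTo-distribˡ-* B c f)) (sym (*-distribˡ-+ c (sumTo B f) (f (suc B))))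

sumTo-vanishing-tail : ∀ f {B B′} → (∀ k → B < k → f k ≡ 0) → B ≤ B′ → sumTo B′ f ≡ sumTo B f
sumTo-vanishing-tail f {B′ = zero} vanish z≤n = refl
sumTo-vanishing-tail f {B′ = suc B′} vanish B≤1+B′ with m≤n⇒m<n∨m≡n B≤1+B′
... | inj₂ refl = refl
... | inj₁ B<1+B′ =
  trans (cong₂ _+_ (sumTo-vanishing-tail f vanish (≤-pred B<1+B′)) (vanish (suc B′) B<1+B′)) (+-identityʳ _)

sumTo-zero-below : ∀ B {f} → (∀ k → k ≤ B → f k ≡ 0) → sumTo B f ≡ 0
sumTo-zero-below zero vanish = refl
sumTo-zero-below (suc B) vanish =
  cong₂ _+_ (sumTo-zero-below B (λ k k≤B → vanish k (m≤n⇒m≤1+n k≤B))) (vanish (suc B) ≤-refl)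

term≤sumTo : ∀ f B j → 1 ≤ j → j ≤ B → f j ≤ sumTo B f
term≤sumTo f zero j 1≤j j≤0 = ⊥-elim (<⇒≱ 1≤j j≤0)
term≤sumTo f (suc B) j 1≤j j≤1+B with j ≟ suc B
... | yes refl = m≤n+m (f (suc B)) (sumTo B f)
... | no j≢1+B = ≤-trans (term≤sumTo f B j 1≤j (≤-pred (≤∧≢⇒< j≤1+B j≢1+B))) (m≤m+n _ _)

sumFrom : ℕ → ℕ → (ℕ → ℕ) → ℕ
sumFrom zero k v = 0
sumFrom (suc c) k v = v k + sumFrom c (suc k) v

sumFrom-distribˡ-* : ∀ c k b v → sumFrom c k (λ j → b ℕ.* v j) ≡ b ℕ.* sumFrom c k v
sumFrom-distribˡ-* zero k b v = sym (*-zeroʳ b)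
sumFrom-distribˡ-* (suc c) k b v =
  trans (cong (b ℕ.* v k +_) (sumFrom-distribˡ-* c (suc k) b v)) (sym (*-distribˡ-+ b (v k) (sumFrom c (suc k) v)))

sumFrom-snoc : ∀ c k v → sumFrom (suc c) k v ≡ sumFrom c k v + v (k + c)
sumFrom-snoc zero k v = trans (+-identityʳ (v k)) (cong v (sym (+-identityʳ k)))
sumFrom-snoc (suc c) k v = begin
  v k + sumFrom (suc c) (suc k) v            ≡⟨ cong (v k +_) (sumFrom-snoc c (suc k) v) ⟩
  v k + (sumFrom c (suc k) v + v (suc k + c)) ≡⟨ +-assoc (v k) _ _ ⟨
  v k + sumFrom c (suc k) v + v (suc k + c)   ≡⟨ cong (λ i → sumFrom (suc c) k v + v i) (+-suc k c) ⟨
  sumFrom (suc c) k v + v (k + suc c)         ∎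
  where open ≡-Reasoning

count-nonempty : ∀ {lo hi c} → suc hi ∸ lo ≡ suc c → lo ≤ hi
count-nonempty {lo} {hi} eq with lo ≤? hi
... | yes lo≤hi = lo≤hi
... | no lo≰hi = ⊥-elim (0≢1+n (trans (sym (m≤n⇒m∸n≡0 (≰⇒> lo≰hi))) eq))

count-next : ∀ {lo hi c} → suc hi ∸ lo ≡ suc c → suc hi ∸ suc lo ≡ c
count-next {lo} {hi} eq = suc-injective (trans (sym (+-∸-assoc 1 (count-nonempty {lo} {hi} eq))) eq)

Σc-empty : ∀ lo hi F → suc hi ∸ lo ≡ 0 → Σc lo hi F ≗ 0c
Σc-empty lo hi F eq k rewrite eq = refl

Σc-unfold : ∀ lo hi F → lo ≤ hi → Σc lo hi F ≗ F lo +c Σc (suc lo) hi F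
Σc-unfold lo hi F lo≤hi k rewrite +-∸-assoc 1 lo≤hi = refl

module Value (Q : ℕ → ℕ) where

  term : Coef → ℕ → ℕ
  term δ k = δ k ℕ.* Q k

  private
    term-vanishes : (∀ k → B < k → μ k ≡ 0) → ∀ k → B < k → term μ k ≡ 0
    term-vanishes vanish k B<k = cong (ℕ._* Q k) (vanish k B<k)

  value-sumTo : ∀ B → (∀ k → B < k → μ k ≡ 0) → HasValue μ Q m → sumTo B (term μ) ≡ m
  value-sumTo {μ} B vanish (B′ , vanish′ , sum≡m) = begin
    sumTo B (term μ)        ≡⟨ sumTo-vanishing-tail (term μ) (term-vanishes vanish) (m≤m⊔n B B′) ⟨
    sumTo (B ⊔ B′) (term μ) ≡⟨ sumTo-vanishing-tail (term μ) (term-vanishes vanish′) (m≤n⊔m B B′) ⟩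
    sumTo B′ (term μ)       ≡⟨ sum≡m ⟩
    _                       ∎
    where open ≡-Reasoning

  value-unique : HasValue μ Q m → HasValue μ Q n → m ≡ n
  value-unique (B , vanish , sum≡m) hv = trans (sym sum≡m) (value-sumTo B vanish hv)

  value-resp-≗ : μ ≗ ν → HasValue μ Q m → HasValue ν Q m
  value-resp-≗ eq (B , vanish , sum≡m) =
    B , (λ k B<k → trans (sym (eq k)) (vanish k B<k)) ,
    trans (sumTo-cong B (λ k → cong (ℕ._* Q k) (sym (eq k)))) sum≡m

  value-0c : HasValue 0c Q 0
  value-0c = 0 , (λ _ _ → refl) , refl

  value-exists : FinSupp μ → ∃[ m ] HasValue μ Q m
  value-exists {μ} (B , vanish) = sumTo B (term μ) , B , vanish , refl

  value-+c : HasValue μ Q m → HasValue ν Q n → HasValue (μ +c ν) Q (m + n)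
  value-+c {μ} {ν = ν} (B , vanish , sum≡m) (B′ , vanish′ , sum≡n) =
    B ⊔ B′ ,
    (λ k B⊔B′<k → cong₂ _+_ (vanish k (≤-<-trans (m≤m⊔n B B′) B⊔B′<k))
                            (vanish′ k (≤-<-trans (m≤n⊔m B B′) B⊔B′<k))) ,
    (begin
      sumTo (B ⊔ B′) (term (μ +c ν))
        ≡⟨ sumTo-cong (B ⊔ B′) (λ k → *-distribʳ-+ (Q k) (μ k) (ν k)) ⟩
      sumTo (B ⊔ B′) (λ k → term μ k + term ν k)
        ≡⟨ sumTo-distrib-+ (B ⊔ B′) (term μ) (term ν) ⟩
      sumTo (B ⊔ B′) (term μ) + sumTo (B ⊔ B′) (term ν)
        ≡⟨ cong₂ _+_ (value-sumTo (B ⊔ B′) (λ k lt → vanish k (≤-<-trans (m≤m⊔n B B′) lt)) (B , vanish , sum≡m))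
                     (value-sumTo (B ⊔ B′) (λ k lt → vanish′ k (≤-<-trans (m≤n⊔m B B′) lt)) (B′ , vanish′ , sum≡n)) ⟩
      _ ∎)
    where open ≡-Reasoning

  value-·c : ∀ c → HasValue μ Q m → HasValue (c ·c μ) Q (c ℕ.* m)
  value-·c {μ} c (B , vanish , sum≡m) =
    B , (λ k B<k → trans (cong (c ℕ.*_) (vanish k B<k)) (*-zeroʳ c)) ,
    trans (sumTo-cong B (λ k → *-assoc c (μ k) (Q k)))
          (trans (sumTo-distribˡ-* B c (term μ)) (cong (c ℕ.*_) sum≡m))

  value-β : 1 ≤ n → HasValue (β n) Q (Q n)
  value-β {suc n} _ =
    suc n , (λ k 1+n<k → β-offdiag (λ eq → <-irrefl eq 1+n<k)) ,
    cong₂ _+_ (sumTo-zero-below n (λ k k≤n → cong (ℕ._* Q k) (β-offdiag (λ eq → <-irrefl (sym eq) (s≤s k≤n)))))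
              (trans (cong (ℕ._* Q (suc n)) (β-diag (suc n))) (+-identityʳ (Q (suc n))))

  Q≤value : 1 ≤ j → 1 ≤ μ j → HasValue μ Q m → Q j ≤ m
  Q≤value {j} {μ} 1≤j 1≤μj (B , vanish , sum≡m) = begin
    Q j              ≤⟨ m≤m*n (Q j) (μ j) ⦃ >-nonZero 1≤μj ⦄ ⟩
    Q j ℕ.* μ j      ≡⟨ *-comm (Q j) (μ j) ⟩
    term μ j         ≤⟨ term≤sumTo (term μ) B j 1≤j j≤B ⟩
    sumTo B (term μ) ≡⟨ sum≡m ⟩
    _                ∎
    where
    open ≤-Reasoning
    j≤B : j ≤ B
    j≤B with j ≤? B
    ... | yes j≤B = j≤B
    ... | no j≰B = ⊥-elim (<⇒≱ 1≤μj (≤-reflexive (vanish j (≰⇒> j≰B))))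

  value-Σc : ∀ c lo hi F v → suc hi ∸ lo ≡ c → (∀ k → lo ≤ k → k ≤ hi → HasValue (F k) Q (v k)) →
             HasValue (Σc lo hi F) Q (sumFrom c lo v)
  value-Σc zero lo hi F v eq values = value-resp-≗ (≗-sym (Σc-empty lo hi F eq)) value-0c
  value-Σc (suc c) lo hi F v eq values =
    value-resp-≗ (≗-sym (Σc-unfold lo hi F lo≤hi))
      (value-+c (values lo ≤-refl lo≤hi)
                (value-Σc c (suc lo) hi F v (count-next {lo} {hi} eq) (λ k lo<k → values k (<⇒≤ lo<k))))
    where
    lo≤hi : lo ≤ hi
    lo≤hi = count-nonempty {lo} {hi} eq

upperPart : ℕ → Coef → Coef
upperPart n μ k with k <? n
... | yes _ = 0
... | no _ = μ k

upperPart-finSupp : ∀ n → FinSupp μ → FinSupp (upperPart n μ)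
upperPart-finSupp {μ} n (B , vanish) = B , vanish′
  where
  vanish′ : ∀ k → B < k → upperPart n μ k ≡ 0
  vanish′ k B<k with k <? n
  ... | yes _ = refl
  ... | no _ = vanish k B<k

succShape≗β+upperPart : ∀ n μ → succShape n μ ≗ β n +c upperPart n μ
succShape≗β+upperPart n μ k with k <? n
... | yes _ = sym (+-identityʳ _)
... | no _ = refl

module Zeckendorf {E : Coef → Set} {βh : ℕ → Coef} (Z : IsZeckendorfCollection E βh)
                  {Q : ℕ → ℕ} (FS : IsFundamentalSequence E Q) where

  open IsZeckendorfCollection Z
  open IsFundamentalSequence FS
  open Value Q
  open RawMonad (¬¬-Monad {0ℓ}) using (pure; _>>=_)

  E-trichotomy : E μ → E ν → Trichotomy μ ν
  E-trichotomy {μ} {ν} μ∈ ν∈ = <a-trichotomy (finSupp μ μ∈) (finSupp ν ν∈)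

  Q-monotone : 1 ≤ i → i ≤ j → Q i ≤ Q j
  Q-monotone {j = zero} 1≤i i≤0 = ⊥-elim (<⇒≱ 1≤i i≤0)
  Q-monotone {j = suc j} 1≤i i≤1+j with m≤n⇒m<n∨m≡n i≤1+j
  ... | inj₂ refl = ≤-refl
  ... | inj₁ (s≤s i≤j) = ≤-trans (Q-monotone 1≤i i≤j) (<⇒≤ (increasing j (≤-trans 1≤i i≤j)))

  β≤a⇒Q≤value : 1 ≤ k → β k ≤a μ → HasValue μ Q m → Q k ≤ m
  β≤a⇒Q≤value 1≤k (inj₂ eq) hv = ≤-reflexive (value-unique (value-β 1≤k) (value-resp-≗ (≗-sym eq) hv))
  β≤a⇒Q≤value {k} 1≤k (inj₁ (j , βkj<μj , above)) hv with <-cmp j k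
  ... | tri< j<k _ _ = Q≤value 1≤k (≤-reflexive (trans (sym (β-diag k)) (above k j<k))) hv
  ... | tri≈ _ refl _ = Q≤value 1≤k (≤-trans z<s βkj<μj) hv
  ... | tri> _ _ k<j = ≤-trans (Q-monotone 1≤k (<⇒≤ k<j)) (Q≤value (≤-trans 1≤k (<⇒≤ k<j)) (≤-trans z<s βkj<μj) hv)

  Q₁≡1 : Q 1 ≡ 1
  Q₁≡1 with covers 1 ≤-refl
  ... | δ , δ∈ , δ≢0 , hv with <a-trichotomy (finSupp 0c zero∈) (finSupp δ δ∈)
  ...   | inj₂ (inj₁ eq) = ⊥-elim (δ≢0 (≗-sym eq))
  ...   | inj₂ (inj₂ (_ , () , _))
  ...   | inj₁ (zero , lt , _) = ⊥-elim (<-irrefl (sym (pos0 δ δ∈)) lt)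
  ...   | inj₁ (suc j , lt , _) =
    ≤-antisym (≤-trans (Q-monotone ≤-refl (s≤s z≤n)) (Q≤value (s≤s z≤n) lt hv)) (positive 1 ≤-refl)

  rep-spec : ∀ r → ∃[ δ ] E δ × HasValue δ Q r
  rep-spec zero = 0c , zero∈ , value-0c
  rep-spec (suc r) with covers (suc r) (s≤s z≤n)
  ... | δ , δ∈ , _ , hv = δ , δ∈ , hv

  rep : ℕ → Coef
  rep r = proj₁ (rep-spec r)

  rep-∈ : ∀ r → E (rep r)
  rep-∈ r = proj₁ (proj₂ (rep-spec r))

  rep-value : ∀ r → HasValue (rep r) Q r
  rep-value r = proj₂ (proj₂ (rep-spec r))

  rep-unique : E μ → HasValue μ Q r → μ ≗ rep r
  rep-unique {μ} {r} μ∈ hv = distinct μ (rep r) r μ∈ (rep-∈ r) hv (rep-value r)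

  rep-injective : rep i ≗ rep j → i ≡ j
  rep-injective {i} {j} eq = value-unique (value-resp-≗ eq (rep-value i)) (rep-value j)

  immSucc-respˡ-≗ : μ ≗ μ′ → IsImmSucc E μ ν → IsImmSucc E μ′ ν
  immSucc-respˡ-≗ eq (μ<ν , least) =
    <a-resp-≗ eq (λ _ → refl) μ<ν , λ ρ ρ∈ μ′<ρ → least ρ ρ∈ (<a-resp-≗ (≗-sym eq) (λ _ → refl) μ′<ρ)

  immSucc-respʳ-≗ : ν ≗ ν′ → IsImmSucc E μ ν → IsImmSucc E μ ν′
  immSucc-respʳ-≗ eq (μ<ν , least) =
    <a-resp-≗ (λ _ → refl) eq μ<ν , λ ρ ρ∈ μ<ρ → ≤a-resp-≗ eq (λ _ → refl) (least ρ ρ∈ μ<ρ)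

  β-immSucc-βh : 2 ≤ n → IsImmSucc E (βh n) (β n)
  β-immSucc-βh {n} 2≤n = pred< n 2≤n , least
    where
    least : ∀ ρ → E ρ → βh n <a ρ → β n ≤a ρ
    least ρ ρ∈ βh<ρ with E-trichotomy ρ∈ (β∈ n (≤-trans (s≤s z≤n) 2≤n))
    ... | inj₁ ρ<β = ⊥-elim (<a-irrefl (<a-≤a-trans βh<ρ (predMax n 2≤n ρ ρ∈ ρ<β)))
    ... | inj₂ (inj₁ eq) = inj₂ (≗-sym eq)
    ... | inj₂ (inj₂ β<ρ) = inj₁ β<ρ

  βh-vanishes : 2 ≤ n → n ≤ k → βh n k ≡ 0
  βh-vanishes {n} {k} 2≤n n≤k with pred< n 2≤n
  ... | j , lt , above with j ≟ n
  ...   | no j≢n = ⊥-elim (<⇒≱ lt (≤-trans (≤-reflexive (β-offdiag (λ eq → j≢n (sym eq)))) z≤n))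
  ...   | yes refl with k ≟ j
  ...     | yes refl = n<1⇒n≡0 (subst (βh j j <_) (β-diag j) lt)
  ...     | no k≢j = trans (above k (≤∧≢⇒< n≤k (λ eq → k≢j (sym eq)))) (β-offdiag (λ eq → k≢j (sym eq)))

  ≗βh+upperPart : E μ → 2 ≤ n → (∀ k → 1 ≤ k → k < n → μ k ≡ βh n k) → μ ≗ βh n +c upperPart n μ
  ≗βh+upperPart {μ} {n} μ∈ 2≤n agree k with k <? n
  ≗βh+upperPart {μ} {n} μ∈ 2≤n agree zero | yes _ =
    trans (pos0 μ μ∈) (sym (trans (+-identityʳ _) (pos0 _ (pred∈ n 2≤n))))
  ≗βh+upperPart {μ} {n} μ∈ 2≤n agree (suc k) | yes k<n = trans (agree (suc k) (s≤s z≤n) k<n) (sym (+-identityʳ _))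
  ≗βh+upperPart {μ} {n} μ∈ 2≤n agree k | no k≮n = sym (cong (_+ μ k) (βh-vanishes 2≤n (≮⇒≥ k≮n)))

  ImmSuccChain : ℕ → Set
  ImmSuccChain r = ∀ i → i < r → IsImmSucc E (rep i) (rep (suc i))

  chain-restrict : s ≤ r → ImmSuccChain r → ImmSuccChain s
  chain-restrict s≤r chain i i<s = chain i (<-≤-trans i<s s≤r)

  chain-monotone : ImmSuccChain r → i ≤ r → rep i ≤a rep r
  chain-monotone {zero} chain z≤n = inj₂ (λ _ → refl)
  chain-monotone {suc r} chain i≤1+r with m≤n⇒m<n∨m≡n i≤1+r
  ... | inj₂ refl = inj₂ (λ _ → refl)
  ... | inj₁ (s≤s i≤r) =
    inj₁ (≤a-<a-trans (chain-monotone (chain-restrict (n≤1+n r) chain) i≤r) (proj₁ (chain r ≤-refl)))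

  chain-complete : ImmSuccChain r → E ρ → ρ ≤a rep r → ∃[ i ] i ≤ r × ρ ≗ rep i
  chain-complete {zero} chain ρ∈ (inj₁ (_ , lt , _)) = ⊥-elim (<⇒≱ lt z≤n)
  chain-complete {r} chain ρ∈ (inj₂ eq) = r , ≤-refl , eq
  chain-complete {suc r} chain ρ∈ (inj₁ ρ<rep) with E-trichotomy ρ∈ (rep-∈ r)
  ... | inj₁ lt with chain-complete (chain-restrict (n≤1+n r) chain) ρ∈ (inj₁ lt)
  ...   | i , i≤r , eq = i , m≤n⇒m≤1+n i≤r , eq
  chain-complete {suc r} chain ρ∈ (inj₁ ρ<rep) | inj₂ (inj₁ eq) = r , n≤1+n r , eq
  chain-complete {suc r} chain ρ∈ (inj₁ ρ<rep) | inj₂ (inj₂ gt) =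
    ⊥-elim (<a-irrefl (≤a-<a-trans (proj₂ (chain r ≤-refl) _ ρ∈ gt) ρ<rep))

  chain-next-above : ImmSuccChain r → rep r <a rep (suc r)
  chain-next-above {r} chain with E-trichotomy (rep-∈ r) (rep-∈ (suc r))
  ... | inj₁ lt = lt
  ... | inj₂ (inj₁ eq) = ⊥-elim (1+n≢n (sym (rep-injective eq)))
  ... | inj₂ (inj₂ gt) with chain-complete chain (rep-∈ (suc r)) (inj₁ gt)
  ...   | i , i≤r , eq = ⊥-elim (<⇒≱ (s≤s i≤r) (≤-reflexive (rep-injective eq)))

  Q≡suc-index : ImmSuccChain s → 2 ≤ n → βh n ≗ rep s → Q n ≡ suc s
  Q≡suc-index {s} {n} chain 2≤n βh≗rep = ≤-antisym Qn≤1+s 1+s≤Qn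
    where
    1≤n : 1 ≤ n
    1≤n = ≤-trans (s≤s z≤n) 2≤n
    β≤a-next : β n ≤a rep (suc s)
    β≤a-next = proj₂ (immSucc-respˡ-≗ βh≗rep (β-immSucc-βh 2≤n)) _ (rep-∈ (suc s)) (chain-next-above chain)
    Qn≤1+s : Q n ≤ suc s
    Qn≤1+s = β≤a⇒Q≤value 1≤n β≤a-next (rep-value (suc s))
    1+s≤Qn : suc s ≤ Q n
    1+s≤Qn with Q n ≤? s
    ... | no Qn≰s = ≰⇒> Qn≰s
    ... | yes Qn≤s = ⊥-elim (<a-irrefl (≤a-<a-trans β≤a-βh (pred< n 2≤n)))
      where
      β≤a-βh : β n ≤a βh n
      β≤a-βh = ≤a-resp-≗ (≗-sym (rep-unique (β∈ n 1≤n) (value-β 1≤n))) (≗-sym βh≗rep)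
                          (chain-monotone chain Qn≤s)

  value-succShape : ImmSuccChain r → 2 ≤ n → (∀ k → 1 ≤ k → k < n → rep r k ≡ βh n k) →
                    HasValue (succShape n (rep r)) Q (suc r)
  value-succShape {r} {n} chain 2≤n agree = subst (HasValue _ Q) Qn+u≡1+r
    (value-resp-≗ (≗-sym (succShape≗β+upperPart n (rep r))) (value-+c (value-β 1≤n) (proj₂ u-value)))
    where
    1≤n : 1 ≤ n
    1≤n = ≤-trans (s≤s z≤n) 2≤n
    u-value : ∃[ v ] HasValue (upperPart n (rep r)) Q v
    u-value = value-exists (upperPart-finSupp n (finSupp (rep r) (rep-∈ r)))
    βh-value : ∃[ v ] HasValue (βh n) Q v
    βh-value = value-exists (finSupp (βh n) (pred∈ n 2≤n))
    rep≗ : rep r ≗ βh n +c upperPart n (rep r)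
    rep≗ = ≗βh+upperPart (rep-∈ r) 2≤n agree
    r≡βh+u : r ≡ proj₁ βh-value + proj₁ u-value
    r≡βh+u = value-unique (rep-value r) (value-resp-≗ (≗-sym rep≗) (value-+c (proj₂ βh-value) (proj₂ u-value)))
    βh≤a-rep : βh n ≤a rep r
    βh≤a-rep = pointwise-≤⇒≤a (finSupp (βh n) (pred∈ n 2≤n)) (finSupp (rep r) (rep-∈ r))
                              (λ k → ≤-trans (m≤m+n _ _) (≤-reflexive (sym (rep≗ k))))
    Qn≡1+βh : Q n ≡ suc (proj₁ βh-value)
    Qn≡1+βh with chain-complete chain (pred∈ n 2≤n) βh≤a-rep
    ... | s , s≤r , βh≗rep =
      trans (Q≡suc-index (chain-restrict s≤r chain) 2≤n βh≗rep)
            (cong suc (value-unique (value-resp-≗ (≗-sym βh≗rep) (rep-value s)) (proj₂ βh-value)))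
    Qn+u≡1+r : Q n + proj₁ u-value ≡ suc r
    Qn+u≡1+r = trans (cong (_+ proj₁ u-value) Qn≡1+βh) (cong suc (sym r≡βh+u))

  value-immSucc : ImmSuccChain r → E ν → IsImmSucc E (rep r) ν → Dec (ν ≗ β 1 +c rep r) →
                  HasValue ν Q (suc r)
  value-immSucc {r} chain ν∈ succ (yes ν≗) = subst (HasValue _ Q) (cong (_+ r) Q₁≡1)
    (value-resp-≗ (≗-sym ν≗) (value-+c (value-β ≤-refl) (rep-value r)))
  value-immSucc {r} chain ν∈ succ (no ν≢) with succCond (rep r) _ (rep-∈ r) ν∈ succ ν≢
  ... | n , 2≤n , agree , ν≗ = value-resp-≗ (≗-sym ν≗) (value-succShape chain 2≤n agree)

  module _ {μ : Coef} (μ∈ : E μ) where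

    ImmSuccCandidate : Coef → List Coef → Set
    ImmSuccCandidate c L = ∀ ρ → E ρ → μ <a ρ → c ≤a ρ ⊎ Any (ρ ≗_) L

    immSucc-search : ∀ L c → E c → μ <a c → ImmSuccCandidate c L →
                     DoubleNegation (∃[ ν ] E ν × IsImmSucc E μ ν)
    immSucc-search [] c c∈ μ<c cand = pure (c , c∈ , μ<c , λ ρ ρ∈ μ<ρ → [ id , (λ ()) ] (cand ρ ρ∈ μ<ρ))
    immSucc-search (ℓ ∷ L) c c∈ μ<c cand = ¬¬-excluded-middle {A = E ℓ × μ <a ℓ × ℓ <a c} >>= λ
      { (yes (ℓ∈ , μ<ℓ , ℓ<c)) → immSucc-search L ℓ ℓ∈ μ<ℓ (replace ℓ∈ ℓ<c)
      ; (no ¬between) → immSucc-search L c c∈ μ<c (discard ¬between) }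
      where
      replace : E ℓ → ℓ <a c → ImmSuccCandidate ℓ L
      replace ℓ∈ ℓ<c ρ ρ∈ μ<ρ with cand ρ ρ∈ μ<ρ
      ... | inj₁ c≤ρ = inj₁ (inj₁ (<a-≤a-trans ℓ<c c≤ρ))
      ... | inj₂ (here ρ≗ℓ) = inj₁ (inj₂ (≗-sym ρ≗ℓ))
      ... | inj₂ (there ρ∈L) = inj₂ ρ∈L
      discard : ¬ (E ℓ × μ <a ℓ × ℓ <a c) → ImmSuccCandidate c L
      discard ¬between ρ ρ∈ μ<ρ with cand ρ ρ∈ μ<ρ
      ... | inj₁ c≤ρ = inj₁ c≤ρ
      ... | inj₂ (there ρ∈L) = inj₂ ρ∈L
      ... | inj₂ (here ρ≗ℓ) with E-trichotomy c∈ ρ∈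
      ...   | inj₁ c<ρ = inj₁ (inj₁ c<ρ)
      ...   | inj₂ (inj₁ c≗ρ) = inj₁ (inj₂ c≗ρ)
      ...   | inj₂ (inj₂ ρ<c) = ⊥-elim (¬between (resp ρ ℓ ρ≗ℓ ρ∈ , <a-resp-≗ (λ _ → refl) ρ≗ℓ μ<ρ ,
                                                   <a-resp-≗ ρ≗ℓ (λ _ → refl) ρ<c))

    immSucc-exists : DoubleNegation (∃[ ν ] E ν × IsImmSucc E μ ν)
    immSucc-exists with finSupp μ μ∈
    ... | B , vanish with finBelow (β (suc B)) (β∈ (suc B) (s≤s z≤n))
    ...   | L , below =
      immSucc-search L (β (suc B)) (β∈ (suc B) (s≤s z≤n)) (<a-β-above-support vanish) cand
      where
      cand : ImmSuccCandidate (β (suc B)) L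
      cand ρ ρ∈ μ<ρ with E-trichotomy ρ∈ (β∈ (suc B) (s≤s z≤n))
      ... | inj₁ ρ<β = inj₂ (below ρ ρ∈ ρ<β)
      ... | inj₂ (inj₁ ρ≗β) = inj₁ (inj₂ (≗-sym ρ≗β))
      ... | inj₂ (inj₂ β<ρ) = inj₁ (inj₁ β<ρ)

  chain-step : ImmSuccChain r → DoubleNegation (IsImmSucc E (rep r) (rep (suc r)))
  chain-step {r} chain = do
    ν , ν∈ , succ ← immSucc-exists (rep-∈ r)
    ν≗? ← ¬¬-excluded-middle
    pure (immSucc-respʳ-≗ (rep-unique ν∈ (value-immSucc chain ν∈ succ ν≗?)) succ)

  chain-exists : ∀ r → DoubleNegation (ImmSuccChain r)
  chain-exists zero = pure (λ _ ())
  chain-exists (suc r) = do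
    chain ← chain-exists r
    next ← chain-step chain
    pure (extend chain next)
    where
    extend : ImmSuccChain r → IsImmSucc E (rep r) (rep (suc r)) → ImmSuccChain (suc r)
    extend chain next i (s≤s i≤r) with m≤n⇒m<n∨m≡n i≤r
    ... | inj₁ i<r = chain i i<r
    ... | inj₂ refl = next

  Q≡1+value-βh : 2 ≤ n → HasValue (βh n) Q m → Q n ≡ suc m
  Q≡1+value-βh {n} {m} 2≤n hv = decidable-stable (Q n ≟ suc m) do
    chain ← chain-exists m
    pure (Q≡suc-index chain 2≤n (rep-unique (pred∈ n 2≤n) hv))

-- Opened only from here on: the prefix +_ of ℤ makes sections such as (x +_) of ℕ ambiguous.
open import Data.Integer using (ℤ; +_; _*_; _-_; 0ℤ; 1ℤ) renaming (_+_ to _+ℤ_)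

sumFromℤ : ℕ → ℕ → (ℕ → ℤ) → ℤ
sumFromℤ zero k f = 0ℤ
sumFromℤ (suc c) k f = f k +ℤ sumFromℤ c (suc k) f

sumFromℤ-cong : ∀ c k {f g : ℕ → ℤ} → (∀ j → f j ≡ g j) → sumFromℤ c k f ≡ sumFromℤ c k g
sumFromℤ-cong zero k eq = refl
sumFromℤ-cong (suc c) k eq = cong₂ _+ℤ_ (eq k) (sumFromℤ-cong c (suc k) eq)

pos-sumFrom : ∀ c k v → + sumFrom c k v ≡ sumFromℤ c k (λ j → + v j)
pos-sumFrom zero k v = refl
pos-sumFrom (suc c) k v = trans (ℤ.pos-+ (v k) (sumFrom c (suc k) v)) (cong (+ v k +ℤ_) (pos-sumFrom c (suc k) v))

Σℤ≡sumFromℤ : ∀ c lo hi f → suc hi ∸ lo ≡ c → Σℤ lo hi f ≡ sumFromℤ c lo f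
Σℤ≡sumFromℤ zero lo hi f eq rewrite eq = refl
Σℤ≡sumFromℤ (suc c) lo hi f eq rewrite +-∸-assoc 1 (count-nonempty {lo} {hi} eq) =
  cong (f lo +ℤ_) (Σℤ≡sumFromℤ c (suc lo) hi f (count-next {lo} {hi} eq))

-- Both sides are moved so that no difference of sums occurs: the identity can then be
-- substituted through a refl pattern in recurrence-from-closed-forms.
summation-by-parts : ∀ (f g : ℕ → ℤ) c m →
  sumFromℤ c (suc m) (λ j → f j * g j)
    ≡ sumFromℤ c (suc m) (λ j → f j * g (suc j))
      +ℤ (sumFromℤ c (suc m) (λ j → (f j - f (j ∸ 1)) * g j) +ℤ f m * g (suc m) - f (m + c) * g (suc (m + c)))
summation-by-parts f g zero m rewrite +-identityʳ m = cancel (f m * g (suc m))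
  where
  cancel : ∀ x → 0ℤ ≡ 0ℤ +ℤ (0ℤ +ℤ x - x)
  cancel = solve-∀
summation-by-parts f g (suc c) m = begin
  f (suc m) * g (suc m) +ℤ sumFromℤ c (suc (suc m)) (λ j → f j * g j)
    ≡⟨ cong (f (suc m) * g (suc m) +ℤ_) (summation-by-parts f g c (suc m)) ⟩
  f (suc m) * g (suc m) +ℤ (Y +ℤ (S +ℤ f (suc m) * g (suc (suc m)) - T (suc m + c)))
    ≡⟨ regroup (f (suc m)) (f m) (g (suc m)) (g (suc (suc m))) Y S (T (suc m + c)) ⟩
  f (suc m) * g (suc (suc m)) +ℤ Y
    +ℤ ((f (suc m) - f m) * g (suc m) +ℤ S +ℤ f m * g (suc m) - T (suc m + c))
    ≡⟨ cong (λ i → f (suc m) * g (suc (suc m)) +ℤ Y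
                     +ℤ ((f (suc m) - f m) * g (suc m) +ℤ S +ℤ f m * g (suc m) - T i)) (+-suc m c) ⟨
  f (suc m) * g (suc (suc m)) +ℤ Y
    +ℤ ((f (suc m) - f m) * g (suc m) +ℤ S +ℤ f m * g (suc m) - T (m + suc c)) ∎
  where
  open ≡-Reasoning
  Y S : ℤ
  Y = sumFromℤ c (suc (suc m)) (λ j → f j * g (suc j))
  S = sumFromℤ c (suc (suc m)) (λ j → (f j - f (j ∸ 1)) * g j)
  T : ℕ → ℤ
  T i = f i * g (suc i)
  regroup : ∀ a a′ x x′ y s t →
    a * x +ℤ (y +ℤ (s +ℤ a * x′ - t)) ≡ a * x′ +ℤ y +ℤ ((a - a′) * x +ℤ s +ℤ a′ * x - t)
  regroup = solve-∀

Δext : ∀ {N} → (Fin N → ℕ) → ℕ → ℤ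
Δext e k = + ext e k - + ext e (k ∸ 1)

sumFromℤ-Δext : ∀ N (e : Fin N → ℕ) (g : ℕ → ℤ) →
  sumFromℤ N 1 (λ k → Δext e k * g k) ≡ + ext e 1 * g 1 +ℤ Σℤ 2 N (λ k → Δext e k * g k)
sumFromℤ-Δext zero e g = lemma (g 1)   -- ext e 1 = 0 when N = 0
  where
  lemma : ∀ x → 0ℤ ≡ 0ℤ * x +ℤ 0ℤ
  lemma = solve-∀
sumFromℤ-Δext (suc N) e g =
  cong₂ _+ℤ_ (cong (_* g 1) (ℤ.+-identityʳ (+ ext e 1))) (sym (Σℤ≡sumFromℤ N 2 (suc N) _ refl))

-- 0ℤ * Qn-1 is the boundary term e₀ Q (n - 1) of the summation by parts, with e₀ = 0.
recurrence-from-closed-forms : ∀ (Qn Qn-1 Qx A B Wn Wn-1 D S E₁ E_N : ℤ) →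
  Qn ≡ 1ℤ +ℤ (B * (A +ℤ Qx) +ℤ Wn) →
  Qn-1 ≡ 1ℤ +ℤ (B * A +ℤ Wn-1) →
  Wn ≡ Wn-1 +ℤ (D +ℤ 0ℤ * Qn-1 - E_N * Qx) →
  D ≡ E₁ * Qn-1 +ℤ S →
  Qn ≡ ((E₁ +ℤ 1ℤ) * Qn-1 +ℤ S) +ℤ (B - E_N) * Qx
recurrence-from-closed-forms _ _ Qx A B _ Wn-1 _ S E₁ E_N refl refl refl refl = lemma Qx A B Wn-1 S E₁ E_N
  where
  lemma : ∀ Qx A B Wn-1 S E₁ E_N →
    1ℤ +ℤ (B * (A +ℤ Qx) +ℤ (Wn-1 +ℤ (E₁ * (1ℤ +ℤ (B * A +ℤ Wn-1)) +ℤ S +ℤ 0ℤ * (1ℤ +ℤ (B * A +ℤ Wn-1)) - E_N * Qx)))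
      ≡ ((E₁ +ℤ 1ℤ) * (1ℤ +ℤ (B * A +ℤ Wn-1)) +ℤ S) +ℤ (B - E_N) * Qx
  lemma = solve-∀

pos-affine : ∀ b a w → + suc (b ℕ.* a + w) ≡ 1ℤ +ℤ (+ b * + a +ℤ + w)
pos-affine b a w =
  trans (ℤ.pos-+ 1 (b ℕ.* a + w)) (cong (1ℤ +ℤ_) (trans (ℤ.pos-+ (b ℕ.* a) w) (cong (_+ℤ + w) (ℤ.pos-* b a))))

module Recurrence (N b : ℕ) (e : Fin N → ℕ) {E : Coef → Set} (Z : IsZeckendorfCollection E (βhatSpec N b e))
                  {Q : ℕ → ℕ} (FS : IsFundamentalSequence E Q) where

  open Zeckendorf Z FS using (Q₁≡1; Q≡1+value-βh)
  open Value Q using (value-β; value-·c; value-+c; value-Σc)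

  partialSum : ℕ → ℕ
  partialSum x = sumFrom x 1 Q

  weightedTail : ℕ → ℕ
  weightedTail n = sumFrom N 1 (λ k → ext e k ℕ.* Q (n ∸ k))

  weightedTail-value : N < n → HasValue (Σc 1 N (λ k → ext e k ·c β (n ∸ k))) Q (weightedTail n)
  weightedTail-value N<n =
    value-Σc N 1 N _ _ refl (λ k _ k≤N → value-·c (ext e k) (value-β (m<n⇒0<n∸m (≤-<-trans k≤N N<n))))

  scaledPartialSum-value : ∀ c → HasValue (Σc 1 c (λ k → b ·c β k)) Q (b ℕ.* partialSum c)
  scaledPartialSum-value c = subst (HasValue _ Q) (sumFrom-distribˡ-* c 1 b Q)
    (value-Σc c 1 c _ (λ k → b ℕ.* Q k) refl (λ k 1≤k _ → value-·c b (value-β 1≤k)))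

  βhat-value : N ≤ p → HasValue (βhatSpec N b e (suc p)) Q (b ℕ.* partialSum (p ∸ N) + weightedTail (suc p))
  βhat-value {p} N≤p with suc p ≤? suc N
  ... | no _ = value-+c (subst (λ c → HasValue (Σc 1 (suc p ∸ N ∸ 1) (λ k → b ·c β k)) Q (b ℕ.* partialSum c))
                                (cong (_∸ 1) (+-∸-assoc 1 N≤p)) (scaledPartialSum-value (suc p ∸ N ∸ 1)))
                         (weightedTail-value (s≤s N≤p))
  ... | yes 1+p≤1+N with ≤-antisym (≤-pred 1+p≤1+N) N≤p
  ...   | refl = subst (HasValue _ Q) (cong (_+ weightedTail (suc p)) b*partialSum0≡0) (weightedTail-value ≤-refl)
    where
    b*partialSum0≡0 : 0 ≡ b ℕ.* partialSum (p ∸ p)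
    b*partialSum0≡0 = sym (trans (cong (λ c → b ℕ.* partialSum c) (n∸n≡0 p)) (*-zeroʳ b))

  Q-closed-form : N ≤ p → Q (suc p) ≡ suc (b ℕ.* partialSum (p ∸ N) + weightedTail (suc p))
  Q-closed-form {zero} N≤0 with n≤0⇒n≡0 N≤0
  ... | refl = trans Q₁≡1 (cong suc (sym (trans (+-identityʳ _) (*-zeroʳ b))))
  Q-closed-form {suc p} N≤1+p = Q≡1+value-βh (s≤s (s≤s z≤n)) (βhat-value N≤1+p)

  pos-weightedTail : ∀ n → + weightedTail n ≡ sumFromℤ N 1 (λ k → + ext e k * + Q (n ∸ k))
  pos-weightedTail n = trans (pos-sumFrom N 1 _) (sumFromℤ-cong N 1 (λ k → ℤ.pos-* (ext e k) (Q (n ∸ k))))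

  recurrence : ∀ n → 2 + N ≤ n →
    + Q n ≡ ((+ (ext e 1 + 1)) * (+ Q (n ∸ 1))
              +ℤ Σℤ 2 N (λ k → (+ ext e k - + ext e (k ∸ 1)) * (+ Q (n ∸ k))))
              +ℤ (+ b - + ext e N) * (+ Q (n ∸ N ∸ 1))
  recurrence n@(suc (suc q)) (s≤s (s≤s N≤q)) =
    trans (recurrence-from-closed-forms (+ Q n) (g 1) (+ Q (suc x)) (+ partialSum x) (+ b)
             (+ weightedTail n) (+ weightedTail (suc q)) D S (+ ext e 1) (+ ext e N)
             closed-n closed-n-1 tail-step head)
          (cong₂ (λ c i → (c * g 1 +ℤ S) +ℤ (+ b - + ext e N) * + Q i) (sym (ℤ.pos-+ (ext e 1) 1)) (sym n∸N∸1≡1+x))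
    where
    open ≡-Reasoning
    x : ℕ
    x = q ∸ N
    g : ℕ → ℤ
    g k = + Q (n ∸ k)
    S D : ℤ
    S = Σℤ 2 N (λ k → Δext e k * g k)
    D = sumFromℤ N 1 (λ k → Δext e k * g k)
    1+q∸N≡1+x : suc q ∸ N ≡ suc x
    1+q∸N≡1+x = +-∸-assoc 1 N≤q
    n∸N∸1≡1+x : n ∸ N ∸ 1 ≡ suc x
    n∸N∸1≡1+x = trans (cong (_∸ 1) (+-∸-assoc 1 (m≤n⇒m≤1+n N≤q))) 1+q∸N≡1+x
    closed-n : + Q n ≡ 1ℤ +ℤ (+ b * (+ partialSum x +ℤ + Q (suc x)) +ℤ + weightedTail n)
    closed-n = begin
      + Q n
        ≡⟨ cong +_ (Q-closed-form (m≤n⇒m≤1+n N≤q)) ⟩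
      + suc (b ℕ.* partialSum (suc q ∸ N) + weightedTail n)
        ≡⟨ cong (λ c → + suc (b ℕ.* partialSum c + weightedTail n)) 1+q∸N≡1+x ⟩
      + suc (b ℕ.* partialSum (suc x) + weightedTail n)
        ≡⟨ pos-affine b (partialSum (suc x)) (weightedTail n) ⟩
      1ℤ +ℤ (+ b * + partialSum (suc x) +ℤ + weightedTail n)
        ≡⟨ cong (λ s → 1ℤ +ℤ (+ b * s +ℤ + weightedTail n))
                (trans (cong +_ (sumFrom-snoc x 1 Q)) (ℤ.pos-+ (partialSum x) (Q (suc x)))) ⟩
      1ℤ +ℤ (+ b * (+ partialSum x +ℤ + Q (suc x)) +ℤ + weightedTail n) ∎
    closed-n-1 : g 1 ≡ 1ℤ +ℤ (+ b * + partialSum x +ℤ + weightedTail (suc q))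
    closed-n-1 = trans (cong +_ (Q-closed-form N≤q)) (pos-affine b (partialSum x) (weightedTail (suc q)))
    tail-step : + weightedTail n ≡ + weightedTail (suc q) +ℤ (D +ℤ 0ℤ * g 1 - + ext e N * + Q (suc x))
    tail-step = begin
      + weightedTail n
        ≡⟨ pos-weightedTail n ⟩
      sumFromℤ N 1 (λ k → + ext e k * g k)
        ≡⟨ summation-by-parts (λ k → + ext e k) g N 0 ⟩
      sumFromℤ N 1 (λ k → + ext e k * g (suc k)) +ℤ (D +ℤ 0ℤ * g 1 - + ext e N * g (suc N))
        ≡⟨ cong₂ (λ w i → w +ℤ (D +ℤ 0ℤ * g 1 - + ext e N * + Q i))
                 (sym (pos-weightedTail (suc q))) 1+q∸N≡1+x ⟩
      + weightedTail (suc q) +ℤ (D +ℤ 0ℤ * g 1 - + ext e N * + Q (suc x)) ∎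
    head : D ≡ + ext e 1 * g 1 +ℤ S
    head = sumFromℤ-Δext N e g

-- The hypotheses b > 0 (for N = 0) and e₁ ≥ 1 only ensure that such a collection exists;
-- the recurrence itself does not need them.
proposition3p1 : (N b : ℕ) → (N ≡ 0 → 0 < b) → (e : Fin N → ℕ) → (0 < N → 1 ≤ ext e 1) →
    (E : Coef → Set) → IsZeckendorfCollection E (βhatSpec N b e) →
    (Q : ℕ → ℕ) → IsFundamentalSequence E Q →
    ∀ n → N + 2 ≤ n →
    + Q n ≡ ((+ (ext e 1 + 1)) * (+ Q (n ∸ 1))
              +ℤ Σℤ 2 N (λ k → (+ ext e k - + ext e (k ∸ 1)) * (+ Q (n ∸ k))))
              +ℤ (+ b - + ext e N) * (+ Q (n ∸ N ∸ 1))
proposition3p1 N b _ e _ E Z Q FS n N+2≤n =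
  Recurrence.recurrence N b e Z FS n (subst (_≤ n) (+-comm N 2) N+2≤n)
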